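{- Let $\pi$ be an involution that avoids the pattern $4321$ and is an inflation of $21$, i.e. $\pi = 21[\alpha_1,\alpha_2]$ for some nonempty permutations $\alpha_1,\alpha_2$. For $k\ge 1$ let $\iota_k = 1\,2\,\cdots\,k$ denote the identity permutation of length $k$. Then either $\pi = 21[\iota_n,\iota_n]$ for some $n\ge 1$, or $\pi = 321[\iota_n,\iota_m,\iota_n]$ for some $n,m\ge 1$.
   Context: A permutation $\pi\in S_n$ avoids a pattern $s\in S_k$ if no subsequence of $\pi$ is order-isomorphic to $s$. An involution is a permutation $\pi$ with $\pi(\pi(i))=i$ for all $i$. For $\sigma\in S_k$ and permutations $\alpha_1,\dots,\alpha_k$, the inflation $\sigma[\alpha_1,\dots,\alpha_k]$ is the permutation obtained by replacing the $i$-th entry $\sigma(i)$ of $\sigma$ by a block of consecutive positions whose entries form a set of consecutive values and are order-isomorphic to $\alpha_i$, the blocks being arranged relative to each other (in positions and values) as the entries of $\sigma$. -}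

module Defs where

open import Data.Nat using (ℕ; zero; suc; _+_; _<_; _≤_)
open import Data.List using (List; []; _∷_; length; map; concat; sum; upTo; zip; filter)
open import Data.List.Relation.Binary.Permutation.Propositional using (_↭_)
open import Data.List.Relation.Binary.Sublist.Propositional using (_⊆_)
open import Data.Product using (_×_; Σ; ∃; proj₁; proj₂; _,_)
open import Data.Nat using (_<?_)
open import Relation.Binary.PropositionalEquality using (_≡_)
open import Relation.Nullary using (¬_)
open import Function.Bundles using (_⇔_)

-- Permutations are written in one-line notation as lists of naturals,
-- using values 0,1,…,n-1 (0-based).
IsPerm : List ℕ → Set
IsPerm xs = xs ↭ upTo (length xs)

-- i-th entry (0-based); default 0 outside the range (never used in range)
at : List ℕ → ℕ → ℕ
at []       _       = 0
at (x ∷ xs) zero    = x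
at (x ∷ xs) (suc i) = at xs i

IsInvolution : List ℕ → Set
IsInvolution π = ∀ i → i < length π → at π (at π i) ≡ i

OrderIso : List ℕ → List ℕ → Set
OrderIso xs ys =
  length xs ≡ length ys ×
  (∀ i j → i < length xs → j < length xs → (at xs i < at xs j) ⇔ (at ys i < at ys j))

Contains : List ℕ → List ℕ → Set
Contains π s = Σ (List ℕ) λ xs → (xs ⊆ π) × OrderIso xs s

Avoids : List ℕ → List ℕ → Set
Avoids π s = ¬ Contains π s

ι : ℕ → List ℕ
ι k = upTo k

-- Inflation σ[α₁,…,α_k]: block i is α_i with all values shifted by the
-- total length of the blocks α_j with σ(j) < σ(i).
private
  offset : List ℕ → List (List ℕ) → ℕ → ℕ
  offset []       _        v = 0
  offset (_ ∷ _)  []       v = 0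
  offset (s ∷ σ)  (a ∷ αs) v with s <? v
  ... | Relation.Nullary.yes _ = length a + offset σ αs v
  ... | Relation.Nullary.no  _ = offset σ αs v

  blocks : List ℕ → List (List ℕ) → List ℕ → List (List ℕ) → List (List ℕ)
  blocks σ αs []       _        = []
  blocks σ αs (_ ∷ _)  []       = []
  blocks σ αs (s ∷ τ)  (a ∷ βs) = map (λ x → x + offset σ αs s) a ∷ blocks σ αs τ βs

inflate : List ℕ → List (List ℕ) → List ℕ
inflate σ αs = concat (blocks σ αs σ αs)

p21 p321 p4321 : List ℕ
p21   = 1 ∷ 0 ∷ []
p321  = 2 ∷ 1 ∷ 0 ∷ []
p4321 = 3 ∷ 2 ∷ 1 ∷ 0 ∷ []

-- Write π = 21[α₁, α₂] with |α₁| = a ≤ b = |α₂| (the case b ≤ a is symmetric, since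
-- an involution is also a skew sum with the block lengths swapped).  Because π is an
-- involution it maps the positions [0,a), [a,b), [b,a+b) onto the values [b,a+b),
-- [a,b), [0,a) respectively.  On each of these three intervals π is increasing: a
-- descent above (resp. below) the diagonal together with its mirror image under π
-- gives a 4321, and a descent in the middle block lies between π(0) ≥ b and π(b) < a.
-- An increasing bijection between two intervals is a translation, so
-- π = 321[ι_a, ι_(b-a), ι_a], which is 21[ι_a, ι_a] when a = b.
module Submission where

open import Defs
open import Data.Nat using (ℕ; zero; suc; _+_; _∸_; _≤_; _<_; z≤n; s≤s; z<s; s<s; s≤s⁻¹)
open import Data.Nat.Properties
open import Data.List using (List; []; _∷_; length; map; _++_; upTo; applyUpTo; drop)
open import Data.List.Properties
  using (length-map; length-++; length-upTo; ++-identityʳ; map-cong; map-id; map-upTo; drop-all)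
open import Data.List.Membership.Propositional using (_∈_)
open import Data.List.Membership.Propositional.Properties using (∈-map⁻; ∈-upTo⁻)
open import Data.List.Relation.Unary.Any using (here; there)
open import Data.List.Relation.Binary.Permutation.Propositional.Properties using (∈-resp-↭)
open import Data.List.Relation.Binary.Sublist.Propositional using (_⊆_; _∷_; _∷ʳ_; minimum)
open import Data.Product using (_×_; Σ; _,_)
open import Data.Sum using (_⊎_; inj₁; inj₂; [_,_]′)
open import Function using (_∘_)
open import Function.Bundles using (_⇔_; mk⇔)
open import Function.Construct.Composition using (_⇔-∘_)
open import Function.Construct.Symmetry using (⇔-sym)
open import Relation.Binary using (tri<; tri≈; tri>)
open import Relation.Binary.PropositionalEquality
open import Relation.Nullary using (¬_; contradiction)

at-∈ : ∀ xs {i} → i < length xs → at xs i ∈ xs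
at-∈ (x ∷ xs) {zero}  _         = here refl
at-∈ (x ∷ xs) {suc i} (s≤s i<n) = there (at-∈ xs i<n)

at-++-∈ˡ : ∀ xs ys {i} → i < length xs → at (xs ++ ys) i ∈ xs
at-++-∈ˡ (x ∷ xs) ys {zero}  _         = here refl
at-++-∈ˡ (x ∷ xs) ys {suc i} (s≤s i<n) = there (at-++-∈ˡ xs ys i<n)

at-++-∈ʳ : ∀ xs ys {i} → length xs ≤ i → i < length (xs ++ ys) → at (xs ++ ys) i ∈ ys
at-++-∈ʳ []       ys         _         i<n       = at-∈ ys i<n
at-++-∈ʳ (x ∷ xs) ys {suc i} (s≤s n≤i) (s≤s i<n) = at-++-∈ʳ xs ys n≤i i<n

drop≡applyUpTo-++-drop : ∀ (g : ℕ → ℕ) s L xs → s + L ≤ length xs →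
  (∀ {k} → k < L → at xs (s + k) ≡ g k) → drop s xs ≡ applyUpTo g L ++ drop (s + L) xs
drop≡applyUpTo-++-drop g zero    zero    xs       _          _     = refl
drop≡applyUpTo-++-drop g zero    (suc L) (x ∷ xs) (s≤s L≤n)  agree =
  cong₂ _∷_ (agree z<s) (drop≡applyUpTo-++-drop (g ∘ suc) zero L xs L≤n (agree ∘ s<s))
drop≡applyUpTo-++-drop g (suc s) L       (x ∷ xs) (s≤s sL≤n) agree =
  drop≡applyUpTo-++-drop g s L xs sL≤n agree

length-nonempty : ∀ {xs : List ℕ} → ¬ xs ≡ [] → 1 ≤ length xs
length-nonempty {[]}    xs≢[] = contradiction refl xs≢[]
length-nonempty {_ ∷ _} _     = s≤s z≤n

at-<-length : ∀ {π i} → IsPerm π → i < length π → at π i < length π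
at-<-length {π} perm i<n = ∈-upTo⁻ (∈-resp-↭ perm (at-∈ π i<n))

module _ {g : ℕ → ℕ} {L : ℕ} (increasing : ∀ {k} → suc k < L → g k < g (suc k)) where

  increasing-+ : ∀ d {i} → d + i < L → d + g i ≤ g (d + i)
  increasing-+ zero    _  = ≤-refl
  increasing-+ (suc d) lt = ≤-<-trans (increasing-+ d (<⇒≤ lt)) (increasing lt)

  translation : ∀ {lo} → (∀ {k} → k < L → lo ≤ g k) → (∀ {k} → k < L → g k < lo + L) →
                ∀ {k} → k < L → g k ≡ lo + k
  translation {lo} lower upper {k} k<L = ≤-antisym g≤ ≤g
    where
    open ≤-Reasoning

    ≤g : lo + k ≤ g k
    ≤g = begin
      lo + k      ≡⟨ +-comm lo k ⟩
      k + lo      ≤⟨ +-monoʳ-≤ k (lower (≤-<-trans z≤n k<L)) ⟩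
      k + g 0     ≤⟨ increasing-+ k (subst (_< L) (sym (+-identityʳ k)) k<L) ⟩
      g (k + 0)   ≡⟨ cong g (+-identityʳ k) ⟩
      g k         ∎

    d = L ∸ suc k

    L≡ : L ≡ suc (d + k)
    L≡ = trans (sym (m∸n+n≡m k<L)) (+-suc d k)

    d+k<L : d + k < L
    d+k<L = subst (d + k <_) (sym L≡) ≤-refl

    g≤ : g k ≤ lo + k
    g≤ = +-cancelˡ-≤ d (g k) (lo + k) (begin
      d + g k          ≤⟨ increasing-+ d d+k<L ⟩
      g (d + k)        ≤⟨ s≤s⁻¹ (subst (g (d + k) <_) (trans (cong (lo +_) L≡) (+-suc lo (d + k)))
                                  (upper d+k<L)) ⟩
      lo + (d + k)     ≡⟨ +-comm lo (d + k) ⟩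
      (d + k) + lo     ≡⟨ +-assoc d k lo ⟩
      d + (k + lo)     ≡⟨ cong (d +_) (+-comm k lo) ⟩
      d + (lo + k)     ∎)

Decreasing : List ℕ → Set
Decreasing xs = ∀ {i j} → i < j → j < length xs → at xs j < at xs i

[-]-decreasing : ∀ x → Decreasing (x ∷ [])
[-]-decreasing x {j = zero}  ()
[-]-decreasing x {j = suc j} _ (s≤s ())

∷-decreasing : ∀ {x y xs} → y < x → Decreasing (y ∷ xs) → Decreasing (x ∷ y ∷ xs)
∷-decreasing y<x dec {zero}  {suc zero}    _         _         = y<x
∷-decreasing y<x dec {zero}  {suc (suc j)} _         (s≤s j<n) = <-trans (dec z<s j<n) y<x
∷-decreasing y<x dec {suc i} {suc j}       (s≤s i<j) (s≤s j<n) = dec i<j j<n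

decreasing-⇔ : ∀ {xs i j} → Decreasing xs → i < length xs → j < length xs →
               (at xs i < at xs j ⇔ j < i)
decreasing-⇔ {xs} {i} {j} dec i<n j<n = mk⇔ reversed (λ j<i → dec j<i i<n)
  where
  reversed : at xs i < at xs j → j < i
  reversed lt with <-cmp i j
  ... | tri< i<j _ _  = contradiction lt (<-asym (dec i<j j<n))
  ... | tri≈ _ refl _ = contradiction lt (<-irrefl refl)
  ... | tri> _ _ j<i  = j<i

decreasing-orderIso : ∀ {xs ys} → Decreasing xs → Decreasing ys → length xs ≡ length ys →
                      OrderIso xs ys
decreasing-orderIso {xs} {ys} decx decy len = len , λ i j i<n j<n →
  ⇔-sym (decreasing-⇔ {ys} decy (subst (i <_) len i<n) (subst (j <_) len j<n))
    ⇔-∘ decreasing-⇔ {xs} decx i<n j<n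

p4321-decreasing : Decreasing p4321
p4321-decreasing =
  ∷-decreasing (n<1+n 2) (∷-decreasing (n<1+n 1) (∷-decreasing (n<1+n 0) ([-]-decreasing 0)))

at-∷-⊆-drop : ∀ {ys} xs {k i} → k ≤ i → i < length xs → ys ⊆ drop (suc i) xs →
              at xs i ∷ ys ⊆ drop k xs
at-∷-⊆-drop (x ∷ xs) {zero}  {zero}  _         _          ys⊆ = refl ∷ ys⊆
at-∷-⊆-drop (x ∷ xs) {zero}  {suc i} _         (s≤s i<n)  ys⊆ = x ∷ʳ at-∷-⊆-drop xs z≤n i<n ys⊆
at-∷-⊆-drop (x ∷ xs) {suc k} {suc i} (s≤s k≤i) (s≤s i<n)  ys⊆ = at-∷-⊆-drop xs k≤i i<n ys⊆

contains-4321 : ∀ {π p q r s} → p < q → q < r → r < s → s < length π →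
  at π q < at π p → at π r < at π q → at π s < at π r → Contains π p4321
contains-4321 {π} {p} {q} {r} {s} p<q q<r r<s s<n q↓p r↓q s↓r =
  _ , sublist , decreasing-orderIso decreasing p4321-decreasing refl
  where
  r<n = <-trans r<s s<n
  q<n = <-trans q<r r<n
  sublist = at-∷-⊆-drop π z≤n (<-trans p<q q<n) (at-∷-⊆-drop π p<q q<n
              (at-∷-⊆-drop π q<r r<n (at-∷-⊆-drop π r<s s<n (minimum _))))
  decreasing = ∷-decreasing q↓p (∷-decreasing r↓q (∷-decreasing s↓r ([-]-decreasing _)))

record SkewSum (π : List ℕ) (a b : ℕ) : Set where
  field
    length≡ : length π ≡ a + b
    high    : ∀ {i} → i < a → b ≤ at π i
    low     : ∀ {i} → a ≤ i → i < length π → at π i < b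

inflate-21 : ∀ α β → inflate p21 (α ∷ β ∷ []) ≡ map (_+ length β) α ++ β
inflate-21 α β = cong₂ _++_ (map-cong (λ x → cong (x +_) (+-identityʳ (length β))) α)
                            (trans (++-identityʳ _) (trans (map-cong +-identityʳ β) (map-id β)))

skewSum-++ : ∀ α {β} → IsPerm β → SkewSum (map (_+ length β) α ++ β) (length α) (length β)
skewSum-++ α {β} perm = record
  { length≡ = trans (length-++ (map _ α)) (cong (_+ length β) (length-map _ α))
  ; high    = λ i<a → high (∈-map⁻ (_+ length β)
                 (at-++-∈ˡ (map _ α) β (subst (_ <_) (sym (length-map _ α)) i<a)))
  ; low     = λ a≤i i<n → ∈-upTo⁻ (∈-resp-↭ perm
                 (at-++-∈ʳ (map _ α) β (subst (_≤ _) (sym (length-map _ α)) a≤i) i<n))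
  }
  where
  high : ∀ {v} → Σ ℕ (λ x → x ∈ α × v ≡ x + length β) → length β ≤ v
  high (x , _ , refl) = m≤n+m (length β) x

skewSum-inflate-21 : ∀ α β → IsPerm β → SkewSum (inflate p21 (α ∷ β ∷ [])) (length α) (length β)
skewSum-inflate-21 α β perm = subst (λ π → SkewSum π _ _) (sym (inflate-21 α β)) (skewSum-++ α perm)

module _ {π : List ℕ} (perm : IsPerm π) (inv : IsInvolution π) where

  at-injective : ∀ {i j} → i < length π → j < length π → at π i ≡ at π j → i ≡ j
  at-injective {i} {j} i<n j<n eq = trans (sym (inv i i<n)) (trans (cong (at π) eq) (inv j j<n))

  ascent : ∀ {i} → suc i < length π → ¬ at π (suc i) < at π i → at π i < at π (suc i)
  ascent si<n no-descent =
    ≤∧≢⇒< (≮⇒≥ no-descent) (λ eq → 1+n≢n (sym (at-injective (<⇒≤ si<n) si<n eq)))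

  skewSum-sym : ∀ {a b} → SkewSum π a b → SkewSum π b a
  skewSum-sym {a} {b} skew = record
    { length≡ = trans length≡ (+-comm a b)
    ; high    = λ {i} i<b → ≮⇒≥ λ πi<a →
        <⇒≱ i<b (subst (b ≤_) (inv i (i<n i<b)) (high πi<a))
    ; low     = λ {i} b≤i i<n → ≰⇒> λ a≤πi →
        <⇒≱ (subst (_< b) (inv i i<n) (low a≤πi (at-<-length perm i<n))) b≤i
    }
    where
    open SkewSum skew
    i<n : ∀ {i} → i < b → i < length π
    i<n i<b = subst (_ <_) (sym length≡) (<-≤-trans i<b (m≤n+m b a))

  -- The 4321 is the descent p < q together with its mirror image π(q) < π(p); the two
  -- descents come in this order above the diagonal and in the reverse order below it.
  descent-above-diagonal : ∀ {p q} → p < q → q < length π → q < at π q → at π q < at π p →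
                           Contains π p4321
  descent-above-diagonal {p} {q} p<q q<n q<πq πq<πp =
    contains-4321 p<q q<πq πq<πp (at-<-length perm p<n) πq<πp
      (subst (_< at π q) (sym (inv q q<n)) q<πq)
      (subst₂ _<_ (sym (inv p p<n)) (sym (inv q q<n)) p<q)
    where p<n = <-trans p<q q<n

  descent-below-diagonal : ∀ {p q} → p < q → q < length π → at π q < at π p → at π p < p →
                           Contains π p4321
  descent-below-diagonal {p} {q} p<q q<n πq<πp πp<p =
    contains-4321 πq<πp πp<p p<q q<n
      (subst₂ _<_ (sym (inv p p<n)) (sym (inv q q<n)) p<q)
      (subst (at π p <_) (sym (inv p p<n)) πp<p)
      πq<πp
    where p<n = <-trans p<q q<n

module ThreeBlocks {π : List ℕ} (perm : IsPerm π) (inv : IsInvolution π) (avoid : Avoids π p4321)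
  {n m : ℕ} (1≤n : 1 ≤ n) (skew : SkewSum π n (n + m)) where

  private
    module S = SkewSum skew
    module S′ = SkewSum (skewSum-sym perm inv skew)

  first<length : ∀ {i} → i < n + m → i < length π
  first<length i<nm = subst (_ <_) (sym S′.length≡) (<-≤-trans i<nm (m≤m+n (n + m) n))

  last<length : ∀ {k} → k < n → (n + m) + k < length π
  last<length k<n = subst (_ <_) (sym S′.length≡) (+-monoʳ-< (n + m) k<n)

  top : ∀ {k} → k < n → at π k ≡ (n + m) + k
  top = translation increasing S.high upper
    where
    upper : ∀ {k} → k < n → at π k < (n + m) + n
    upper {k} k<n = subst (at π k <_) S′.length≡
      (at-<-length perm (first<length (<-≤-trans k<n (m≤m+n n m))))

    increasing : ∀ {k} → suc k < n → at π k < at π (suc k)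
    increasing {k} sk<n = ascent perm inv sk<length λ descent →
      avoid (descent-above-diagonal perm inv (n<1+n k) sk<length
               (<-≤-trans sk<n (≤-trans (m≤m+n n m) (S.high sk<n))) descent)
      where sk<length = first<length (<-≤-trans sk<n (m≤m+n n m))

  middle : ∀ {k} → k < m → at π (n + k) ≡ n + k
  middle = translation increasing (S′.high ∘ +-monoʳ-< n) upper
    where
    upper : ∀ {k} → k < m → at π (n + k) < n + m
    upper k<m = S.low (m≤m+n n _) (first<length (+-monoʳ-< n k<m))

    increasing : ∀ {k} → suc k < m → at π (n + k) < at π (n + suc k)
    increasing {k} sk<m = subst (λ j → at π (n + k) < at π j) (sym (+-suc n k))
      (ascent perm inv (first<length i+1<n+m) λ descent →
        avoid (contains-4321 (<-≤-trans 1≤n (m≤m+n n k)) (n<1+n (n + k)) i+1<last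
                 (last<length 1≤n)
                 (<-≤-trans (upper (<⇒≤ sk<m)) (S.high 1≤n))
                 descent
                 (<-≤-trans (S′.low (m≤m+n (n + m) 0) (last<length 1≤n)) (S′.high i+1<n+m))))
      where
      i+1<n+m : suc (n + k) < n + m
      i+1<n+m = subst (_< n + m) (+-suc n k) (+-monoʳ-< n sk<m)
      i+1<last : suc (n + k) < (n + m) + 0
      i+1<last = subst (suc (n + k) <_) (sym (+-identityʳ (n + m))) i+1<n+m

  bottom : ∀ {k} → k < n → at π ((n + m) + k) ≡ k
  bottom = translation increasing (λ _ → z≤n) upper
    where
    upper : ∀ {k} → k < n → at π ((n + m) + k) < n
    upper k<n = S′.low (m≤m+n (n + m) _) (last<length k<n)

    increasing : ∀ {k} → suc k < n → at π ((n + m) + k) < at π ((n + m) + suc k)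
    increasing {k} sk<n = subst (λ j → at π ((n + m) + k) < at π j) (sym (+-suc (n + m) k))
      (ascent perm inv sk<length λ descent →
        avoid (descent-below-diagonal perm inv (n<1+n _) sk<length descent
                 (<-≤-trans (upper (<⇒≤ sk<n)) (≤-trans (m≤m+n n m) (m≤m+n (n + m) k)))))
      where sk<length = subst (_< length π) (+-suc (n + m) k) (last<length sk<n)

  layout : π ≡ applyUpTo (_+ (m + n)) n ++ applyUpTo (_+ n) m ++ applyUpTo (_+ 0) n
  layout = begin
    π
      ≡⟨ drop≡applyUpTo-++-drop _ 0 n π (first≤ (m≤m+n n m))
           (λ {k} k<n → trans (top k<n) (top≡ k)) ⟩
    B₁ ++ drop n π
      ≡⟨ cong (B₁ ++_) (drop≡applyUpTo-++-drop _ n m π (first≤ ≤-refl)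
           (λ {k} k<m → trans (middle k<m) (+-comm n k))) ⟩
    B₁ ++ B₂ ++ drop (n + m) π
      ≡⟨ cong (λ t → B₁ ++ B₂ ++ t) (drop≡applyUpTo-++-drop _ (n + m) n π (≤-reflexive (sym S′.length≡))
           (λ {k} k<n → trans (bottom k<n) (sym (+-identityʳ k)))) ⟩
    B₁ ++ B₂ ++ B₃ ++ drop ((n + m) + n) π
      ≡⟨ cong (λ t → B₁ ++ B₂ ++ B₃ ++ t) (drop-all _ π (≤-reflexive S′.length≡)) ⟩
    B₁ ++ B₂ ++ B₃ ++ []
      ≡⟨ cong (λ t → B₁ ++ B₂ ++ t) (++-identityʳ B₃) ⟩
    B₁ ++ B₂ ++ B₃ ∎
    where
    open ≡-Reasoning
    B₁ = applyUpTo (_+ (m + n)) n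
    B₂ = applyUpTo (_+ n) m
    B₃ = applyUpTo (_+ 0) n

    first≤ : ∀ {i} → i ≤ n + m → i ≤ length π
    first≤ i≤ = subst (_ ≤_) (sym S′.length≡) (≤-trans i≤ (m≤m+n (n + m) n))

    top≡ : ∀ k → (n + m) + k ≡ k + (m + n)
    top≡ k = trans (+-comm (n + m) k) (cong (k +_) (+-comm n m))

IdentityBlocks : List ℕ → Set
IdentityBlocks π =
  (Σ ℕ λ n → (1 ≤ n) × (π ≡ inflate p21 (ι n ∷ ι n ∷ [])))
  ⊎ (Σ ℕ λ n → Σ ℕ λ m → (1 ≤ n) × (1 ≤ m) × (π ≡ inflate p321 (ι n ∷ ι m ∷ ι n ∷ [])))

inflate-321-ι : ∀ n m → inflate p321 (ι n ∷ ι m ∷ ι n ∷ []) ≡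
                       applyUpTo (_+ (m + n)) n ++ applyUpTo (_+ n) m ++ applyUpTo (_+ 0) n
inflate-321-ι n m
  rewrite length-upTo n | length-upTo m | +-identityʳ n | ++-identityʳ (map (_+ 0) (upTo n))
        | map-upTo (_+ (m + n)) n | map-upTo (_+ n) m | map-upTo (_+ 0) n = refl

inflate-21-ι : ∀ n → inflate p21 (ι n ∷ ι n ∷ []) ≡ applyUpTo (_+ n) n ++ applyUpTo (_+ 0) n
inflate-21-ι n
  rewrite length-upTo n | +-identityʳ n | ++-identityʳ (map (_+ 0) (upTo n))
        | map-upTo (_+ n) n | map-upTo (_+ 0) n = refl

identityBlocks : ∀ {π} n m → 1 ≤ n →
  π ≡ applyUpTo (_+ (m + n)) n ++ applyUpTo (_+ n) m ++ applyUpTo (_+ 0) n → IdentityBlocks π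
identityBlocks n zero    1≤n eq = inj₁ (n , 1≤n , trans eq (sym (inflate-21-ι n)))
identityBlocks n (suc m) 1≤n eq =
  inj₂ (n , suc m , 1≤n , s≤s z≤n , trans eq (sym (inflate-321-ι n (suc m))))

skewSum-identityBlocks : ∀ {π a b} → IsPerm π → IsInvolution π → Avoids π p4321 →
  1 ≤ a → a ≤ b → SkewSum π a b → IdentityBlocks π
skewSum-identityBlocks perm inv avoid 1≤a a≤b skew with m≤n⇒∃[o]m+o≡n a≤b
... | m , refl = identityBlocks _ m 1≤a (ThreeBlocks.layout perm inv avoid 1≤a skew)

proposition2p4 : (π α₁ α₂ : List ℕ) →
    IsPerm π → IsInvolution π → Avoids π p4321 →
    IsPerm α₁ → IsPerm α₂ → ¬ (α₁ ≡ []) → ¬ (α₂ ≡ []) →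
    π ≡ inflate p21 (α₁ ∷ α₂ ∷ []) →
    (Σ ℕ λ n → (1 ≤ n) × (π ≡ inflate p21 (ι n ∷ ι n ∷ [])))
    ⊎ (Σ ℕ λ n → Σ ℕ λ m → (1 ≤ n) × (1 ≤ m) × (π ≡ inflate p321 (ι n ∷ ι m ∷ ι n ∷ [])))
proposition2p4 π α₁ α₂ perm inv avoid _ perm₂ α₁≢[] α₂≢[] refl =
  [ (λ a≤b → skewSum-identityBlocks perm inv avoid (length-nonempty α₁≢[]) a≤b skew)
  , (λ b≤a → skewSum-identityBlocks perm inv avoid (length-nonempty α₂≢[]) b≤a
                (skewSum-sym perm inv skew))
  ]′ (≤-total (length α₁) (length α₂))
  where skew = skewSum-inflate-21 α₁ α₂ perm₂
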